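{- Let $H=([n],E_H)$ be a connected unweighted graph with $m=|E_H|$ edges and let $\mathrm{mc}(H)=\max_{A\subseteq[n]}|\partial_H(A)|$. Let $G_1'$ be the Sparsest Cut instance with vertex set $V_1=\{s,t\}\cup[n]$, supply edges $\{s,i\},\{t,i\}$ for all $i\in[n]$ with capacities $\mathrm{cap}_{s,i}=\mathrm{cap}_{t,i}=\deg_H(i)/2m$, and demands $\mathrm{dem}_{s,t}=1$ and $\mathrm{dem}_{i,j}=1/m$ if $\{i,j\}\in E_H$ (and $0$ otherwise) for $i,j\in[n]$. Then the sparsest cuts in $G_1'$ separate $s$ from $t$, and have sparsity $m/(m+\mathrm{mc}(H))$.
   Context: For a cut $(S,V\setminus S)$, its sparsity is the total capacity of supply edges with exactly one endpoint in $S$ divided by the total demand of demand pairs with exactly one endpoint in $S$; the sparsest cuts are those of minimum sparsity. $\partial_H(A)$ denotes the set of edges of $H$ with exactly one endpoint in $A$. -}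

module Defs where

open import Data.Nat as ℕ using (ℕ; zero; suc; _<_)
import Data.Nat.Properties as NP
open import Data.Integer using (+_)
open import Data.Fin using (Fin; toℕ)
import Data.Fin as Fin
open import Data.Bool using (Bool; true; false; _xor_; if_then_else_)
open import Data.Rational using (ℚ; 0ℚ; 1ℚ; _+_; _*_; _÷_; _≤_; _/_; ≢-nonZero)
open import Data.Product using (Σ; _×_; ∃)
open import Relation.Binary.PropositionalEquality using (_≡_; _≢_)
open import Relation.Nullary using (¬_)

record Graph (n : ℕ) : Set where
  field
    adj   : Fin n → Fin n → Bool
    sym   : ∀ i j → adj i j ≡ adj j i
    irrefl : ∀ i → adj i i ≡ false
open Graph public

data Walk {n : ℕ} (H : Graph n) : Fin n → Fin n → Set where
  here : ∀ {i} → Walk H i i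
  step : ∀ {i j k} → adj H i j ≡ true → Walk H j k → Walk H i k

Connected : ∀ {n} → Graph n → Set
Connected H = ∀ i j → Walk H i j

sumℕ : ∀ {n} → (Fin n → ℕ) → ℕ
sumℕ {zero}  f = 0
sumℕ {suc n} f = f Fin.zero ℕ.+ sumℕ (λ i → f (Fin.suc i))

sumℚ : ∀ {n} → (Fin n → ℚ) → ℚ
sumℚ {zero}  f = 0ℚ
sumℚ {suc n} f = f Fin.zero + sumℚ (λ i → f (Fin.suc i))

b2ℕ : Bool → ℕ
b2ℕ true  = 1
b2ℕ false = 0

b2ℚ : Bool → ℚ
b2ℚ true  = 1ℚ
b2ℚ false = 0ℚ

-- an unordered pair {i,j} is counted once, as i < j
lt : ∀ {n} → Fin n → Fin n → Bool
lt i j = Data.Nat._<ᵇ_ (toℕ i) (toℕ j)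
  where import Data.Nat

numEdges : ∀ {n} → Graph n → ℕ
numEdges H = sumℕ (λ i → sumℕ (λ j → b2ℕ (lt i j Data.Bool.∧ adj H i j)))
  where import Data.Bool

deg : ∀ {n} → Graph n → Fin n → ℕ
deg H i = sumℕ (λ j → b2ℕ (adj H i j))

cutSize : ∀ {n} → Graph n → (Fin n → Bool) → ℕ
cutSize H A = sumℕ (λ i → sumℕ (λ j →
  b2ℕ (lt i j Data.Bool.∧ adj H i j Data.Bool.∧ (A i xor A j))))
  where import Data.Bool

IsMaxCut : ∀ {n} → Graph n → ℕ → Set
IsMaxCut H mc = (∃ λ A → cutSize H A ≡ mc) × (∀ A → cutSize H A ℕ.≤ mc)

data V₁ (n : ℕ) : Set where
  s t : V₁ n
  v   : Fin n → V₁ n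

Cut : ℕ → Set
Cut n = V₁ n → Bool

sep : ∀ {n} → Cut n → V₁ n → V₁ n → Bool
sep S x y = S x xor S y

-- The instance G₁′ (requires m ≠ 0, since demands are 1/m)
module Instance {n : ℕ} (H : Graph n) .{{m≢0 : ℕ.NonZero (numEdges H)}} where
  m : ℕ
  m = numEdges H

  capSI : Fin n → ℚ
  capSI i = (+ deg H i) / (2 ℕ.* m)
    where instance
            nz : ℕ.NonZero (2 ℕ.* m)
            nz = NP.m*n≢0 2 m

  cap : Cut n → ℚ
  cap S = sumℚ (λ i → (b2ℚ (sep S s (v i)) + b2ℚ (sep S t (v i))) * capSI i)

  demIJ : ℚ
  demIJ = (+ 1) / m

  dem : Cut n → ℚ
  dem S = b2ℚ (sep S s t) + sumℚ (λ i → sumℚ (λ j →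
    b2ℚ (lt i j Data.Bool.∧ adj H i j Data.Bool.∧ sep S (v i) (v j)) * demIJ))
    where import Data.Bool

  sparsity : (S : Cut n) → dem S ≢ 0ℚ → ℚ
  sparsity S p = _÷_ (cap S) (dem S) {{≢-nonZero p}}

  IsSparsest : Cut n → Set
  IsSparsest S = Σ (dem S ≢ 0ℚ) λ p →
    ∀ (T : Cut n) (q : dem T ≢ 0ℚ) → sparsity S p ≤ sparsity T q

  targetValue : ℕ → ℚ
  targetValue mc = _/_ (+ m) (m ℕ.+ mc)
    {{ℕ.>-nonZero (NP.<-≤-trans (ℕ.>-nonZero⁻¹ m) (NP.m≤m+n m mc))}}

module Submission where

-- Write A for the trace of a cut S on [n]. Scaling capacities by 2m and demands by m, S has
-- capacity Σᵢ ([s and i separated] + [t and i separated]) deg i and demand [s, t separated] m + |∂_H(A)|.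
-- If S separates s from t, every i is separated from exactly one of them, so by the handshake lemma
-- the sparsity is m / (m + |∂_H(A)|) ≥ m / (m + mc), with equality when A is a maximum cut.
-- Otherwise the sparsity is vol(B) / |∂_H(A)|, where B is the side of [n] not containing s; every
-- cut edge has an endpoint in B, so the sparsity is at least 1 > m / (m + mc).

open import Defs hiding (sym)
open import Data.Nat as ℕ using (ℕ; zero; suc; pred; NonZero; _+_; _*_; _≤_; _<_; z≤n; s≤s)
import Data.Nat.Properties as NP
open import Algebra.Properties.CommutativeSemigroup NP.+-commutativeSemigroup
  using () renaming (interchange to +-interchange)
open import Data.Nat.Solver using (module +-*-Solver)
open +-*-Solver using (solve; _:+_; _:*_; _:=_; con)
import Data.Integer as ℤ
import Data.Integer.Properties as ZP
open import Data.Rational as Q using (ℚ; 0ℚ; 1ℚ; toℚᵘ; _/_; _÷_)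
import Data.Rational.Properties as QP
open import Data.Rational.Unnormalised as U using (mkℚᵘ; *≡*; *≤*; *<*)
import Data.Rational.Unnormalised.Properties as UP
open import Data.Fin as F using (Fin; toℕ)
import Data.Fin.Properties as FP
open import Data.Bool using (Bool; true; false; not; _∧_; _xor_)
import Data.Bool as B
open import Data.Bool.Properties using (¬-not; xor-same; T-≡)
open import Data.Product using (_×_; ∃; proj₁; _,_)
open import Data.Empty using (⊥-elim)
open import Function using (_∘_)
open import Function.Bundles using (Equivalence)
open import Relation.Binary.PropositionalEquality
open import Relation.Binary.Definitions using (tri<; tri≈; tri>)
open import Relation.Nullary using (yes; no)

infixl 7 _/ℕ_

_/ℕ_ : ℕ → (b : ℕ) .{{_ : NonZero b}} → ℚ
a /ℕ b = ℤ.+ a / b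

toℚᵘ-/ℕ : ∀ a b .{{_ : NonZero b}} → toℚᵘ (a /ℕ b) U.≃ mkℚᵘ (ℤ.+ a) (pred b)
toℚᵘ-/ℕ a (suc k) = QP.toℚᵘ-fromℚᵘ (mkℚᵘ (ℤ.+ a) k)

/ℕ-cong : ∀ a b c d .{{_ : NonZero b}} .{{_ : NonZero d}} → a * d ≡ c * b → a /ℕ b ≡ c /ℕ d
/ℕ-cong a b@(suc _) c d@(suc _) ad≡cb = QP.toℚᵘ-injective (begin-equality
  toℚᵘ (a /ℕ b)          ≃⟨ toℚᵘ-/ℕ a b ⟩
  mkℚᵘ (ℤ.+ a) (pred b)  ≃⟨ *≡* (trans (sym (ZP.pos-* a d)) (trans (cong ℤ.+_ ad≡cb) (ZP.pos-* c b))) ⟩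
  mkℚᵘ (ℤ.+ c) (pred d)  ≃⟨ toℚᵘ-/ℕ c d ⟨
  toℚᵘ (c /ℕ d)          ∎)
  where open UP.≤-Reasoning

/ℕ-mono-≤ : ∀ a b c d .{{_ : NonZero b}} .{{_ : NonZero d}} → a * d ≤ c * b → a /ℕ b Q.≤ c /ℕ d
/ℕ-mono-≤ a b@(suc _) c d@(suc _) ad≤cb = QP.toℚᵘ-cancel-≤ (begin
  toℚᵘ (a /ℕ b)          ≃⟨ toℚᵘ-/ℕ a b ⟩
  mkℚᵘ (ℤ.+ a) (pred b)  ≤⟨ *≤* (subst₂ ℤ._≤_ (ZP.pos-* a d) (ZP.pos-* c b) (ℤ.+≤+ ad≤cb)) ⟩
  mkℚᵘ (ℤ.+ c) (pred d)  ≃⟨ toℚᵘ-/ℕ c d ⟨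
  toℚᵘ (c /ℕ d)          ∎)
  where open UP.≤-Reasoning

/ℕ-mono-< : ∀ a b c d .{{_ : NonZero b}} .{{_ : NonZero d}} → a * d < c * b → a /ℕ b Q.< c /ℕ d
/ℕ-mono-< a b@(suc _) c d@(suc _) ad<cb = QP.toℚᵘ-cancel-< (begin-strict
  toℚᵘ (a /ℕ b)          ≃⟨ toℚᵘ-/ℕ a b ⟩
  mkℚᵘ (ℤ.+ a) (pred b)  <⟨ *<* (subst₂ ℤ._<_ (ZP.pos-* a d) (ZP.pos-* c b) (ℤ.+<+ ad<cb)) ⟩
  mkℚᵘ (ℤ.+ c) (pred d)  ≃⟨ toℚᵘ-/ℕ c d ⟨
  toℚᵘ (c /ℕ d)          ∎)
  where open UP.≤-Reasoning

/ℕ-* : ∀ a b c d .{{_ : NonZero b}} .{{_ : NonZero d}} →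
       (a /ℕ b) Q.* (c /ℕ d) ≡ ((a * c) /ℕ (b * d)) {{NP.m*n≢0 b d}}
/ℕ-* a b@(suc _) c d@(suc _) = QP.toℚᵘ-injective (begin-equality
  toℚᵘ ((a /ℕ b) Q.* (c /ℕ d))                     ≃⟨ QP.toℚᵘ-homo-* (a /ℕ b) (c /ℕ d) ⟩
  toℚᵘ (a /ℕ b) U.* toℚᵘ (c /ℕ d)                  ≃⟨ UP.*-cong (toℚᵘ-/ℕ a b) (toℚᵘ-/ℕ c d) ⟩
  mkℚᵘ (ℤ.+ a) (pred b) U.* mkℚᵘ (ℤ.+ c) (pred d)  ≃⟨ *≡* (cong (ℤ._* ℤ.+ (b * d)) (sym (ZP.pos-* a c))) ⟩
  mkℚᵘ (ℤ.+ (a * c)) (pred (b * d))                ≃⟨ toℚᵘ-/ℕ (a * c) (b * d) ⟨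
  toℚᵘ ((a * c) /ℕ (b * d))                        ∎)
  where open UP.≤-Reasoning

/ℕ-+ : ∀ a b c d .{{_ : NonZero b}} .{{_ : NonZero d}} →
       a /ℕ b Q.+ c /ℕ d ≡ ((a * d + c * b) /ℕ (b * d)) {{NP.m*n≢0 b d}}
/ℕ-+ a b@(suc _) c d@(suc _) = QP.toℚᵘ-injective (begin-equality
  toℚᵘ (a /ℕ b Q.+ c /ℕ d)                         ≃⟨ QP.toℚᵘ-homo-+ (a /ℕ b) (c /ℕ d) ⟩
  toℚᵘ (a /ℕ b) U.+ toℚᵘ (c /ℕ d)                  ≃⟨ UP.+-cong (toℚᵘ-/ℕ a b) (toℚᵘ-/ℕ c d) ⟩
  mkℚᵘ (ℤ.+ a) (pred b) U.+ mkℚᵘ (ℤ.+ c) (pred d)  ≃⟨ *≡* (cong (ℤ._* ℤ.+ (b * d)) numerator) ⟩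
  mkℚᵘ (ℤ.+ (a * d + c * b)) (pred (b * d))        ≃⟨ toℚᵘ-/ℕ (a * d + c * b) (b * d) ⟨
  toℚᵘ ((a * d + c * b) /ℕ (b * d))                ∎)
  where
  open UP.≤-Reasoning
  numerator : ℤ.+ a ℤ.* ℤ.+ d ℤ.+ ℤ.+ c ℤ.* ℤ.+ b ≡ ℤ.+ (a * d + c * b)
  numerator = cong₂ ℤ._+_ (sym (ZP.pos-* a d)) (sym (ZP.pos-* c b))

/ℕ-+-same : ∀ a c b .{{_ : NonZero b}} → a /ℕ b Q.+ c /ℕ b ≡ (a + c) /ℕ b
/ℕ-+-same a c b = trans (/ℕ-+ a b c b) (/ℕ-cong (a * b + c * b) (b * b) (a + c) b {{NP.m*n≢0 b b}}
  (solve 3 (λ a c b → (a :* b :+ c :* b) :* b := (a :+ c) :* (b :* b)) refl a c b))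

0</ℕ : ∀ a b .{{_ : NonZero b}} → 1 ≤ a → 0ℚ Q.< a /ℕ b
0</ℕ a b 1≤a = /ℕ-mono-< 0 1 a b (NP.≤-trans 1≤a (NP.≤-reflexive (sym (NP.*-identityʳ a))))

/ℕ≢0⇒nonZero : ∀ a b .{{_ : NonZero b}} → a /ℕ b ≢ 0ℚ → NonZero a
/ℕ≢0⇒nonZero zero    b a/b≢0 = ⊥-elim (a/b≢0 (QP.0/n≡0 b))
/ℕ≢0⇒nonZero (suc _) b _     = _

/ℕ1-* : ∀ a c d .{{_ : NonZero d}} → (a /ℕ 1) Q.* (c /ℕ d) ≡ (a * c) /ℕ d
/ℕ1-* a c d = trans (/ℕ-* a 1 c d)
  (/ℕ-cong (a * c) (1 * d) (a * c) d {{NP.m*n≢0 1 d}} (cong (a * c *_) (sym (NP.*-identityˡ d))))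

+-nonZeroˡ : ∀ a b .{{_ : NonZero a}} → NonZero (a + b)
+-nonZeroˡ (suc _) _ = _

÷-unique : ∀ p q r .{{_ : Q.NonZero q}} → p ≡ r Q.* q → p ÷ q ≡ r
÷-unique p q r p≡rq = begin
  p ÷ q                  ≡⟨ cong (λ x → x Q.* Q.1/ q) p≡rq ⟩
  r Q.* q Q.* Q.1/ q     ≡⟨ QP.*-assoc r q (Q.1/ q) ⟩
  r Q.* (q Q.* Q.1/ q)   ≡⟨ cong (r Q.*_) (QP.*-inverseʳ q) ⟩
  r Q.* 1ℚ               ≡⟨ QP.*-identityʳ r ⟩
  r                      ∎
  where open ≡-Reasoning

sumℕ-cong : ∀ {n} {f g : Fin n → ℕ} → (∀ i → f i ≡ g i) → sumℕ f ≡ sumℕ g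
sumℕ-cong {zero}  f≡g = refl
sumℕ-cong {suc n} f≡g = cong₂ _+_ (f≡g F.zero) (sumℕ-cong (f≡g ∘ F.suc))

sumℕ-mono-≤ : ∀ {n} {f g : Fin n → ℕ} → (∀ i → f i ≤ g i) → sumℕ f ≤ sumℕ g
sumℕ-mono-≤ {zero}  f≤g = z≤n
sumℕ-mono-≤ {suc n} f≤g = NP.+-mono-≤ (f≤g F.zero) (sumℕ-mono-≤ (f≤g ∘ F.suc))

sumℕ-zero : ∀ n → sumℕ {n} (λ _ → 0) ≡ 0
sumℕ-zero zero    = refl
sumℕ-zero (suc n) = sumℕ-zero n

sumℕ-+ : ∀ {n} (f g : Fin n → ℕ) → sumℕ (λ i → f i + g i) ≡ sumℕ f + sumℕ g
sumℕ-+ {zero}  f g = refl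
sumℕ-+ {suc n} f g = trans (cong ((f F.zero + g F.zero) +_) (sumℕ-+ (f ∘ F.suc) (g ∘ F.suc)))
  (+-interchange (f F.zero) (g F.zero) (sumℕ (f ∘ F.suc)) (sumℕ (g ∘ F.suc)))

sumℕ-*ˡ : ∀ {n} k (f : Fin n → ℕ) → sumℕ (λ i → k * f i) ≡ k * sumℕ f
sumℕ-*ˡ {zero}  k f = sym (NP.*-zeroʳ k)
sumℕ-*ˡ {suc n} k f = trans (cong (k * f F.zero +_) (sumℕ-*ˡ k (f ∘ F.suc)))
  (sym (NP.*-distribˡ-+ k (f F.zero) (sumℕ (f ∘ F.suc))))

sumℕ-comm : ∀ {n k} (f : Fin n → Fin k → ℕ) →
            sumℕ (λ i → sumℕ (λ j → f i j)) ≡ sumℕ (λ j → sumℕ (λ i → f i j))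
sumℕ-comm {zero}  {k} f = sym (sumℕ-zero k)
sumℕ-comm {suc n} {k} f = trans (cong (sumℕ (f F.zero) +_) (sumℕ-comm (f ∘ F.suc)))
  (sym (sumℕ-+ (f F.zero) (λ j → sumℕ (λ i → f (F.suc i) j))))

sumℚ-cong : ∀ {n} {f g : Fin n → ℚ} → (∀ i → f i ≡ g i) → sumℚ f ≡ sumℚ g
sumℚ-cong {zero}  f≡g = refl
sumℚ-cong {suc n} f≡g = cong₂ Q._+_ (f≡g F.zero) (sumℚ-cong (f≡g ∘ F.suc))

sumℚ-/ℕ : ∀ {n} (f : Fin n → ℕ) b .{{_ : NonZero b}} → sumℚ (λ i → f i /ℕ b) ≡ sumℕ f /ℕ b
sumℚ-/ℕ {zero}  f b = sym (QP.0/n≡0 b)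
sumℚ-/ℕ {suc n} f b = trans (cong (f F.zero /ℕ b Q.+_) (sumℚ-/ℕ (f ∘ F.suc) b))
  (/ℕ-+-same (f F.zero) (sumℕ (f ∘ F.suc)) b)

<ᵇ≡true : ∀ {a b} → a < b → (a ℕ.<ᵇ b) ≡ true
<ᵇ≡true a<b = Equivalence.to T-≡ (NP.<⇒<ᵇ a<b)

<ᵇ≡false : ∀ {a b} → b ≤ a → (a ℕ.<ᵇ b) ≡ false
<ᵇ≡false {b = zero}      _         = refl
<ᵇ≡false {suc a} {suc b} (s≤s b≤a) = <ᵇ≡false b≤a

edge : ∀ {n} → Graph n → Fin n → Fin n → ℕ
edge H i j = b2ℕ (lt i j ∧ adj H i j)

adj≡edge+edge : ∀ {n} (H : Graph n) i j → b2ℕ (adj H i j) ≡ edge H i j + edge H j i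
adj≡edge+edge H i j with FP.<-cmp i j
... | tri< i<j _ _ rewrite <ᵇ≡true i<j | <ᵇ≡false (NP.<⇒≤ i<j) = sym (NP.+-identityʳ _)
... | tri> _ _ j<i rewrite <ᵇ≡true j<i | <ᵇ≡false (NP.<⇒≤ j<i) = cong b2ℕ (Graph.sym H i j)
... | tri≈ _ refl _ rewrite <ᵇ≡false (NP.≤-refl {toℕ i}) | irrefl H i = refl

vol : ∀ {n} → Graph n → (Fin n → ℕ) → ℕ
vol H w = sumℕ (λ i → w i * deg H i)

vol≡edgeSum : ∀ {n} (H : Graph n) (w : Fin n → ℕ) →
                vol H w ≡ sumℕ (λ i → sumℕ (λ j → (w i + w j) * edge H i j))
vol≡edgeSum H w = begin
  sumℕ (λ i → w i * deg H i)
    ≡⟨ sumℕ-cong (λ i → sym (sumℕ-*ˡ (w i) (λ j → b2ℕ (adj H i j)))) ⟩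
  Σ² (λ i j → w i * b2ℕ (adj H i j))
    ≡⟨ Σ²-cong (λ i j → trans (cong (w i *_) (adj≡edge+edge H i j)) (NP.*-distribˡ-+ (w i) _ _)) ⟩
  Σ² (λ i j → w i * edge H i j + w i * edge H j i)
    ≡⟨ Σ²-+ (λ i j → w i * edge H i j) (λ i j → w i * edge H j i) ⟩
  Σ² (λ i j → w i * edge H i j) + Σ² (λ i j → w i * edge H j i)
    ≡⟨ cong (Σ² (λ i j → w i * edge H i j) +_) (sumℕ-comm (λ i j → w i * edge H j i)) ⟩
  Σ² (λ i j → w i * edge H i j) + Σ² (λ i j → w j * edge H i j)
    ≡⟨ Σ²-+ (λ i j → w i * edge H i j) (λ i j → w j * edge H i j) ⟨
  Σ² (λ i j → w i * edge H i j + w j * edge H i j)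
    ≡⟨ Σ²-cong (λ i j → NP.*-distribʳ-+ (edge H i j) (w i) (w j)) ⟨
  Σ² (λ i j → (w i + w j) * edge H i j) ∎
  where
  open ≡-Reasoning
  Σ² : (Fin _ → Fin _ → ℕ) → ℕ
  Σ² f = sumℕ (λ i → sumℕ (f i))
  Σ²-cong : ∀ {f g} → (∀ i j → f i j ≡ g i j) → Σ² f ≡ Σ² g
  Σ²-cong f≡g = sumℕ-cong (λ i → sumℕ-cong (f≡g i))
  Σ²-+ : ∀ f g → Σ² (λ i j → f i j + g i j) ≡ Σ² f + Σ² g
  Σ²-+ f g = trans (sumℕ-cong (λ i → sumℕ-+ (f i) (g i))) (sumℕ-+ (sumℕ ∘ f) (sumℕ ∘ g))

handshake : ∀ {n} (H : Graph n) → vol H (λ _ → 1) ≡ 2 * numEdges H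
handshake H = trans (vol≡edgeSum H (λ _ → 1))
  (trans (sumℕ-cong (λ i → sumℕ-*ˡ 2 (edge H i))) (sumℕ-*ˡ 2 (λ i → sumℕ (edge H i))))

xor-triangle : ∀ a x y → b2ℕ (x xor y) ≤ b2ℕ (a xor x) + b2ℕ (a xor y)
xor-triangle a     true  true  = z≤n
xor-triangle a     false false = z≤n
xor-triangle false true  false = s≤s z≤n
xor-triangle true  true  false = s≤s z≤n
xor-triangle false false true  = s≤s z≤n
xor-triangle true  false true  = s≤s z≤n

cutSize≤vol : ∀ {n} (H : Graph n) (a : Bool) (A : Fin n → Bool) →
              cutSize H A ≤ vol H (λ i → b2ℕ (a xor A i))
cutSize≤vol H a A = subst (cutSize H A ≤_) (sym (vol≡edgeSum H (λ i → b2ℕ (a xor A i))))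
  (sumℕ-mono-≤ (λ i → sumℕ-mono-≤ (λ j → crossing≤ (lt i j) (adj H i j) (xor-triangle a (A i) (A j)))))
  where
  crossing≤ : ∀ p q {r k} → b2ℕ r ≤ k → b2ℕ (p ∧ q ∧ r) ≤ k * b2ℕ (p ∧ q)
  crossing≤ false q     _   = z≤n
  crossing≤ true  false _   = z≤n
  crossing≤ true  true  {k = k} r≤k = subst (_ ≤_) (sym (NP.*-identityʳ k)) r≤k

b2ℚ≡b2ℕ/1 : ∀ x → b2ℚ x ≡ b2ℕ x /ℕ 1
b2ℚ≡b2ℕ/1 true  = refl
b2ℚ≡b2ℕ/1 false = refl

b2ℚ-+ : ∀ x y → b2ℚ x Q.+ b2ℚ y ≡ (b2ℕ x + b2ℕ y) /ℕ 1
b2ℚ-+ true  true  = refl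
b2ℚ-+ true  false = refl
b2ℚ-+ false true  = refl
b2ℚ-+ false false = refl

xor-≢ : ∀ {x y} → x ≢ y → x xor y ≡ true
xor-≢ {true}  {false} _   = refl
xor-≢ {false} {true}  _   = refl
xor-≢ {true}  {true}  x≢y = ⊥-elim (x≢y refl)
xor-≢ {false} {false} x≢y = ⊥-elim (x≢y refl)

xor-≢-exactlyOne : ∀ {x y} z → x ≢ y → b2ℕ (x xor z) + b2ℕ (y xor z) ≡ 1
xor-≢-exactlyOne {y = y} z x≢y rewrite ¬-not x≢y = exactlyOne y z
  where
  exactlyOne : ∀ y z → b2ℕ (not y xor z) + b2ℕ (y xor z) ≡ 1
  exactlyOne true  true  = refl
  exactlyOne true  false = refl
  exactlyOne false true  = refl
  exactlyOne false false = refl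

module Sparsity {n} (H : Graph n) .{{_ : NonZero (numEdges H)}} where
  open Instance H

  instance
    2m≢0 : NonZero (2 * m)
    2m≢0 = NP.m*n≢0 2 m

    m+k≢0 : ∀ {k} → NonZero (m + k)
    m+k≢0 {k} = +-nonZeroˡ m k

  crossings : Cut n → Fin n → ℕ
  crossings S i = b2ℕ (sep S s (v i)) + b2ℕ (sep S t (v i))

  capNum : Cut n → ℕ
  capNum S = sumℕ (λ i → crossings S i * deg H i)

  demNum : Cut n → ℕ
  demNum S = b2ℕ (sep S s t) * m + cutSize H (S ∘ v)

  cap≡capNum/2m : ∀ S → cap S ≡ capNum S /ℕ (2 * m)
  cap≡capNum/2m S = trans (sumℚ-cong term) (sumℚ-/ℕ (λ i → crossings S i * deg H i) (2 * m))
    where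
    term : ∀ i → (b2ℚ (sep S s (v i)) Q.+ b2ℚ (sep S t (v i))) Q.* capSI i
               ≡ (crossings S i * deg H i) /ℕ (2 * m)
    term i = trans (cong (Q._* capSI i) (b2ℚ-+ (sep S s (v i)) (sep S t (v i))))
                   (/ℕ1-* (crossings S i) (deg H i) (2 * m))

  dem≡demNum/m : ∀ S → dem S ≡ demNum S /ℕ m
  dem≡demNum/m S = begin
    b2ℚ x Q.+ sumℚ (λ i → sumℚ (λ j → b2ℚ (g i j) Q.* demIJ))
      ≡⟨ cong₂ Q._+_ x≡xm/m (sumℚ-cong (λ i → sumℚ-cong (λ j → term (g i j)))) ⟩
    (b2ℕ x * m) /ℕ m Q.+ sumℚ (λ i → sumℚ (λ j → b2ℕ (g i j) /ℕ m))
      ≡⟨ cong ((b2ℕ x * m) /ℕ m Q.+_) (trans (sumℚ-cong (λ i → sumℚ-/ℕ (λ j → b2ℕ (g i j)) m))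
                                              (sumℚ-/ℕ (λ i → sumℕ (λ j → b2ℕ (g i j))) m)) ⟩
    (b2ℕ x * m) /ℕ m Q.+ cutSize H (S ∘ v) /ℕ m
      ≡⟨ /ℕ-+-same (b2ℕ x * m) (cutSize H (S ∘ v)) m ⟩
    demNum S /ℕ m ∎
    where
    open ≡-Reasoning
    x : Bool
    x = sep S s t
    g : Fin n → Fin n → Bool
    g i j = lt i j ∧ adj H i j ∧ sep S (v i) (v j)
    x≡xm/m : b2ℚ x ≡ (b2ℕ x * m) /ℕ m
    x≡xm/m = trans (b2ℚ≡b2ℕ/1 x) (/ℕ-cong (b2ℕ x) 1 (b2ℕ x * m) m (sym (NP.*-identityʳ (b2ℕ x * m))))
    term : ∀ z → b2ℚ z Q.* demIJ ≡ b2ℕ z /ℕ m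
    term z = trans (cong (Q._* demIJ) (b2ℚ≡b2ℕ/1 z))
                   (trans (/ℕ1-* (b2ℕ z) 1 m) (cong (_/ℕ m) (NP.*-identityʳ (b2ℕ z))))

  demNum-nonZero : ∀ S → dem S ≢ 0ℚ → NonZero (demNum S)
  demNum-nonZero S dem≢0 = /ℕ≢0⇒nonZero (demNum S) m (dem≢0 ∘ trans (dem≡demNum/m S))

  2demNum-nonZero : ∀ S → dem S ≢ 0ℚ → NonZero (2 * demNum S)
  2demNum-nonZero S dem≢0 = NP.m*n≢0 2 (demNum S) {{_}} {{demNum-nonZero S dem≢0}}

  sparsity≡capNum/2demNum : ∀ S (dem≢0 : dem S ≢ 0ℚ) →
    sparsity S dem≢0 ≡ (capNum S /ℕ (2 * demNum S)) {{2demNum-nonZero S dem≢0}}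
  sparsity≡capNum/2demNum S dem≢0 = ÷-unique (cap S) (dem S) (c /ℕ (2 * d)) {{Q.≢-nonZero dem≢0}} (begin
    cap S                         ≡⟨ cap≡capNum/2m S ⟩
    c /ℕ (2 * m)                  ≡⟨ /ℕ-cong c (2 * m) (c * d) (2 * d * m) cross ⟩
    (c * d) /ℕ (2 * d * m)        ≡⟨ /ℕ-* c (2 * d) d m ⟨
    (c /ℕ (2 * d)) Q.* (d /ℕ m)   ≡⟨ cong ((c /ℕ (2 * d)) Q.*_) (dem≡demNum/m S) ⟨
    (c /ℕ (2 * d)) Q.* dem S      ∎)
    where
    open ≡-Reasoning
    c d : ℕ
    c = capNum S
    d = demNum S
    cross : c * (2 * d * m) ≡ c * d * (2 * m)
    cross = solve 3 (λ c d m → c :* (con 2 :* d :* m) := c :* d :* (con 2 :* m)) refl c d m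
    instance
      2d≢0 : NonZero (2 * d)
      2d≢0 = 2demNum-nonZero S dem≢0
      2dm≢0 : NonZero (2 * d * m)
      2dm≢0 = NP.m*n≢0 (2 * d) m

  capNum-separating : ∀ S → S s ≢ S t → capNum S ≡ 2 * m
  capNum-separating S s≢t =
    trans (sumℕ-cong (λ i → cong (_* deg H i) (xor-≢-exactlyOne (S (v i)) s≢t))) (handshake H)

  demNum-separating : ∀ S → S s ≢ S t → demNum S ≡ m + cutSize H (S ∘ v)
  demNum-separating S s≢t rewrite xor-≢ s≢t = cong (_+ cutSize H (S ∘ v)) (NP.*-identityˡ m)

  dem-separating≢0 : ∀ S → S s ≢ S t → dem S ≢ 0ℚ
  dem-separating≢0 S s≢t dem≡0 = QP.<-irrefl (sym dem≡0)
    (subst (0ℚ Q.<_) (sym (dem≡demNum/m S)) (0</ℕ (demNum S) m 1≤demNum))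
    where
    1≤demNum : 1 ≤ demNum S
    1≤demNum = NP.≤-trans (ℕ.>-nonZero⁻¹ m)
                 (subst (m ≤_) (sym (demNum-separating S s≢t)) (NP.m≤m+n m (cutSize H (S ∘ v))))

  farSide : Cut n → Fin n → ℕ
  farSide S i = b2ℕ (S s xor S (v i))

  capNum-nonseparating : ∀ S → S s ≡ S t → capNum S ≡ 2 * vol H (farSide S)
  capNum-nonseparating S s≡t = trans (sumℕ-cong doubled) (sumℕ-*ˡ 2 (λ i → farSide S i * deg H i))
    where
    doubled : ∀ i → crossings S i * deg H i ≡ 2 * (farSide S i * deg H i)
    doubled i rewrite sym s≡t =
      solve 2 (λ u d → (u :+ u) :* d := con 2 :* (u :* d)) refl (farSide S i) (deg H i)

  demNum-nonseparating : ∀ S → S s ≡ S t → demNum S ≡ cutSize H (S ∘ v)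
  demNum-nonseparating S s≡t rewrite s≡t | xor-same (S t) = refl

  sparsity-separating : ∀ S (dem≢0 : dem S ≢ 0ℚ) → S s ≢ S t →
                        sparsity S dem≢0 ≡ targetValue (cutSize H (S ∘ v))
  sparsity-separating S dem≢0 s≢t = trans (sparsity≡capNum/2demNum S dem≢0)
    (/ℕ-cong (capNum S) (2 * demNum S) m (m + k) {{2demNum-nonZero S dem≢0}} cross)
    where
    k : ℕ
    k = cutSize H (S ∘ v)
    cross : capNum S * (m + k) ≡ m * (2 * demNum S)
    cross rewrite capNum-separating S s≢t | demNum-separating S s≢t =
      solve 2 (λ m k → con 2 :* m :* (m :+ k) := m :* (con 2 :* (m :+ k))) refl m k

  1≤sparsity-nonseparating : ∀ S (dem≢0 : dem S ≢ 0ℚ) → S s ≡ S t → 1ℚ Q.≤ sparsity S dem≢0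
  1≤sparsity-nonseparating S dem≢0 s≡t = subst (1ℚ Q.≤_) (sym (sparsity≡capNum/2demNum S dem≢0))
    (/ℕ-mono-≤ 1 1 (capNum S) (2 * demNum S) {{_}} {{2demNum-nonZero S dem≢0}} (begin
      1 * (2 * demNum S)             ≡⟨ NP.*-identityˡ (2 * demNum S) ⟩
      2 * demNum S                   ≡⟨ cong (2 *_) (demNum-nonseparating S s≡t) ⟩
      2 * cutSize H (S ∘ v)          ≤⟨ NP.*-monoʳ-≤ 2 (cutSize≤vol H (S s) (S ∘ v)) ⟩
      2 * vol H (farSide S)          ≡⟨ capNum-nonseparating S s≡t ⟨
      capNum S                       ≡⟨ NP.*-identityʳ (capNum S) ⟨
      capNum S * 1                   ∎))
    where open NP.≤-Reasoning

  targetValue-antitone : ∀ {k k′} → k ≤ k′ → targetValue k′ Q.≤ targetValue k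
  targetValue-antitone {k} {k′} k≤k′ =
    /ℕ-mono-≤ m (m + k′) m (m + k) (NP.*-monoʳ-≤ m (NP.+-monoʳ-≤ m k≤k′))

  targetValue<1 : ∀ {k} → 1 ≤ k → targetValue k Q.< 1ℚ
  targetValue<1 {k} 1≤k = /ℕ-mono-< m (m + k) 1 1 (begin-strict
    m * 1       ≡⟨ NP.*-identityʳ m ⟩
    m           <⟨ NP.m<m+n m 1≤k ⟩
    m + k       ≡⟨ NP.*-identityˡ (m + k) ⟨
    1 * (m + k) ∎)
    where open NP.≤-Reasoning

  module _ {mc : ℕ} (cutSize≤mc : ∀ A → cutSize H A ≤ mc) where

    targetValue<sparsity-nonseparating : ∀ S (dem≢0 : dem S ≢ 0ℚ) → S s ≡ S t →
                                         targetValue mc Q.< sparsity S dem≢0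
    targetValue<sparsity-nonseparating S dem≢0 s≡t =
      QP.<-≤-trans (targetValue<1 1≤mc) (1≤sparsity-nonseparating S dem≢0 s≡t)
      where
      1≤mc : 1 ≤ mc
      1≤mc = NP.≤-trans (ℕ.>-nonZero⁻¹ (demNum S) {{demNum-nonZero S dem≢0}})
               (subst (_≤ mc) (sym (demNum-nonseparating S s≡t)) (cutSize≤mc (S ∘ v)))

    targetValue≤sparsity : ∀ S (dem≢0 : dem S ≢ 0ℚ) → targetValue mc Q.≤ sparsity S dem≢0
    targetValue≤sparsity S dem≢0 with S s B.≟ S t
    ... | yes s≡t = QP.<⇒≤ (targetValue<sparsity-nonseparating S dem≢0 s≡t)
    ... | no  s≢t = subst (targetValue mc Q.≤_) (sym (sparsity-separating S dem≢0 s≢t))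
                          (targetValue-antitone (cutSize≤mc (S ∘ v)))

  separatingCut : (Fin n → Bool) → Cut n
  separatingCut A s     = true
  separatingCut A t     = false
  separatingCut A (v i) = A i

claim4p2 : ∀ {n : ℕ} (H : Graph n) → Connected H
    → .{{m≢0 : NonZero (numEdges H)}}
    → (mc : ℕ) → IsMaxCut H mc
    → (∃ λ S → Instance.IsSparsest H S)
      × (∀ S → Instance.IsSparsest H S → S s ≢ S t)
      × (∀ S → (sp : Instance.IsSparsest H S)
           → Instance.sparsity H S (proj₁ sp) ≡ Instance.targetValue H mc)
claim4p2 {n} H _ mc ((A , cutA≡mc) , cutSize≤mc) =
    (S* , dem*≢0 , λ T dem≢0 → QP.≤-trans (QP.≤-reflexive optimal) (lower T dem≢0))
  , (λ S (dem≢0 , minimal) s≡t →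
       QP.<-irrefl refl (QP.<-≤-trans (strict S dem≢0 s≡t) (upper S dem≢0 minimal)))
  , (λ S (dem≢0 , minimal) → QP.≤-antisym (upper S dem≢0 minimal) (lower S dem≢0))
  where
  open Instance H
  open Sparsity H

  lower : ∀ S (dem≢0 : dem S ≢ 0ℚ) → targetValue mc Q.≤ sparsity S dem≢0
  lower = targetValue≤sparsity cutSize≤mc

  strict : ∀ S (dem≢0 : dem S ≢ 0ℚ) → S s ≡ S t → targetValue mc Q.< sparsity S dem≢0
  strict = targetValue<sparsity-nonseparating cutSize≤mc

  S* : Cut n
  S* = separatingCut A

  dem*≢0 : dem S* ≢ 0ℚ
  dem*≢0 = dem-separating≢0 S* (λ ())

  optimal : sparsity S* dem*≢0 ≡ targetValue mc
  optimal = trans (sparsity-separating S* dem*≢0 (λ ())) (cong targetValue cutA≡mc)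

  upper : ∀ S dem≢0 → (∀ T q → sparsity S dem≢0 Q.≤ sparsity T q) → sparsity S dem≢0 Q.≤ targetValue mc
  upper _ _ minimal = QP.≤-trans (minimal S* dem*≢0) (QP.≤-reflexive optimal)
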